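{- Let $G$ be a graph and let $P$ and $Q$ be two distinct pendent paths in $G$ with origins $u$ and $v$, respectively (possibly $u=v$). Let $x$ be the neighbor of $u$ lying on $P$, and let $y$ be the pendent (degree-one) vertex of $Q$. Let $G'=G-ux+xy$, the graph obtained from $G$ by deleting the edge $ux$ and adding the edge $xy$. Then $SO(G)>SO(G')$.
   Context: All graphs are finite and simple. A pendent path in $G$ is a path $P=uu_1u_2\cdots u_k$ ($k\geq1$) in $G$ such that $d_G(u)\geq 3$, $d_G(u_k)=1$ and $d_G(u_i)=2$ for $i=1,\dots,k-1$; the vertex $u$ is its origin and $k$ its length. For a graph $G$ with edge set $E(G)$ and vertex degrees $d_G(v)$, the Sombor index is $SO(G)=\sum_{uv\in E(G)}\sqrt{d_G(u)^2+d_G(v)^2}$. -}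

module Defs where

open import Data.Bool using (Bool; true; false; if_then_else_; _∧_; _∨_)
open import Data.Nat using (ℕ; zero; suc; _+_; _*_; _≤_; _<?_)
open import Data.Fin using (Fin; toℕ; _≟_)
open import Data.List using (List; []; _∷_; map; concatMap; allFin; foldr)
open import Data.Nat.ListAction using (sum)
open import Data.List.Relation.Unary.Unique.Propositional using (Unique)
open import Data.List.Relation.Binary.Pointwise using (Pointwise)
open import Data.Product using (_×_; ∃; ∃₂)
open import Data.Integer using (+_)
open import Data.Rational as ℚ using (ℚ; 0ℚ; _/_)
open import Relation.Nullary.Decidable using (⌊_⌋)
open import Relation.Binary.PropositionalEquality using (_≡_)

Adj : ℕ → Set
Adj n = Fin n → Fin n → Bool

IsSimple : ∀ {n} → Adj n → Set
IsSimple G = (∀ i j → G i j ≡ G j i) × (∀ i → G i i ≡ false)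

deg : ∀ {n} → Adj n → Fin n → ℕ
deg {n} G v = sum (map (λ w → if G v w then 1 else 0) (allFin n))

-- Tail G w zs : w, zs is the rest of a pendent path starting at the
-- first vertex w after the origin: internal vertices have degree 2,
-- the last vertex has degree 1, consecutive vertices are adjacent.
Tail : ∀ {n} → Adj n → Fin n → List (Fin n) → Set
Tail G w []       = deg G w ≡ 1
Tail G w (z ∷ zs) = (deg G w ≡ 2) × (G w z ≡ true) × Tail G z zs

-- The path u x xs (length ≥ 1) is a pendent path with origin u.
IsPendentPath : ∀ {n} → Adj n → Fin n → Fin n → List (Fin n) → Set
IsPendentPath G u x xs =
  (3 ≤ deg G u) × (G u x ≡ true) × Tail G x xs × Unique (u ∷ x ∷ xs)

lastOf : ∀ {A : Set} → A → List A → A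
lastOf a []       = a
lastOf a (b ∷ bs) = lastOf b bs

sameEdge : ∀ {n} → Fin n → Fin n → Fin n → Fin n → Bool
sameEdge a b c d = (⌊ a ≟ c ⌋ ∧ ⌊ b ≟ d ⌋) ∨ (⌊ a ≟ d ⌋ ∧ ⌊ b ≟ c ⌋)

delAdd : ∀ {n} → Adj n → Fin n → Fin n → Fin n → Adj n
delAdd G u x y a b =
  if sameEdge a b u x then false
  else if sameEdge a b x y then true
  else G a b

-- The radicands d(i)^2 + d(j)^2, one per edge ij (i < j).
soTerms : ∀ {n} → Adj n → List ℕ
soTerms {n} G =
  concatMap (λ i → concatMap (λ j →
      if ⌊ toℕ i <? toℕ j ⌋ ∧ G i j
      then (deg G i * deg G i + deg G j * deg G j) ∷ [] else [])
    (allFin n)) (allFin n)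

ℕtoℚ : ℕ → ℚ
ℕtoℚ k = (+ k) / 1

sumℚ : List ℚ → ℚ
sumℚ = foldr ℚ._+_ 0ℚ

-- SqrtSumGt as bs  :⇔  Σ √a  >  Σ √b  (over the real numbers).
-- Strict inequality of reals is witnessed by rationals: rational lower
-- bounds p ≤ √a and upper bounds q ≥ √b with Σ p > Σ q.
SqrtSumGt : List ℕ → List ℕ → Set
SqrtSumGt as bs = ∃₂ λ (ps qs : List ℚ) →
  Pointwise (λ a p → (0ℚ ℚ.≤ p) × (p ℚ.* p ℚ.≤ ℕtoℚ a)) as ps ×
  Pointwise (λ b q → (0ℚ ℚ.≤ q) × (ℕtoℚ b ℚ.≤ q ℚ.* q)) bs qs ×
  (sumℚ qs ℚ.< sumℚ ps)

SOGt : ∀ {n} → Adj n → Adj n → Set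
SOGt G H = SqrtSumGt (soTerms G) (soTerms H)

{-# OPTIONS --safe #-}
module Submission where

-- Deleting ux and adding xy changes only two degrees: u loses one and the leaf y gets degree 2
-- (x keeps its degree). So SO(G) − SO(G′) is the weight √(d_u² + d_x²) + √(d_w² + 1) of the edges
-- ux, wy of G (w the neighbour of y), minus the weight √(d_x² + 4) + √(d′_w² + 4) of the edges xy, wy
-- of G′, plus what the remaining edges lose, since no other degree grows. As d_u ≥ 3, d_x ≤ 2 and
-- d′_w ≤ d_w with d_w ≥ 2, this difference exceeds 1/10 (the extreme case is √13 + √5 against 2√8).
-- The degree conditions come from the paths: y is the end of Q, so d_y = 1 and d_w ≥ 2, and since a
-- pendent path is determined by its first edge, x is not on Q; hence x ≠ y and x is not adjacent to y.
-- Square roots enter only through ⌊M√t⌋/M ≤ √t ≤ (⌊M√t⌋ + 1)/M with M = 10(N + 1), N the number of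
-- vertex pairs: rounding all edges costs at most N/M, less than the gap (N + 1)/M.

open import Algebra.Properties.CommutativeSemigroup using (interchange)
open import Data.Bool using (Bool; true; false; if_then_else_; _∧_)
open import Data.Bool.Properties using (¬-not)
open import Data.Empty using (⊥; ⊥-elim)
open import Data.Fin using (Fin; zero; suc; toℕ; _≟_)
import Data.Fin.Properties as Fin
open import Data.List using (List; []; _∷_; _++_; map; allFin; tabulate; concatMap; length)
open import Data.List.Properties using (map-tabulate; map-cong; map-++)
open import Data.List.Relation.Unary.All using (All)
open import Data.List.Relation.Binary.Pointwise as Pointwise using (Pointwise)
open import Data.List.Relation.Unary.Any using (here; there)
open import Data.List.Membership.Propositional using (_∈_; _∉_)
open import Data.List.Relation.Unary.Unique.Propositional using (Unique)
open import Data.Nat using (ℕ; zero; suc; pred; _+_; _*_; _≤_; _<_; _<?_; _≤?_; z≤n; s≤s)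
open import Data.Nat.ListAction using (sum)
open import Data.Nat.ListAction.Properties using (sum-++)
open import Data.Nat.Properties hiding (_≟_; suc-injective)
open import Data.Nat.Tactic.RingSolver using (solve-∀)
open import Data.Integer as ℤ using (+≤+; +<+)
open import Data.Integer.Properties using (pos-+; pos-*)
import Data.Integer.Tactic.RingSolver as ℤ-Ring
open import Data.Rational as ℚ using (ℚ; 0ℚ; _/_; toℚᵘ)
open import Data.Rational.Properties using (toℚᵘ-fromℚᵘ; toℚᵘ-injective; toℚᵘ-cancel-≤; toℚᵘ-cancel-<; toℚᵘ-homo-+; toℚᵘ-homo-*)
open import Data.Rational.Unnormalised as ℚᵘ using (mkℚᵘ; *≡*; *≤*; *<*)
open import Data.Rational.Unnormalised.Properties using (≃-refl; ≃-reflexive; ≃-sym; ≃-trans; ≤-respˡ-≃; ≤-respʳ-≃; <-respˡ-≃; <-respʳ-≃; +-cong; *-cong)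
open import Data.Product using (_×_; _,_; proj₁; proj₂; ∃)
open import Data.Sum using (_⊎_; inj₁; inj₂)
open import Function using (id; _∘′_)
open import Relation.Nullary using (¬_; Dec; yes; no; _because_; contradiction)
open import Relation.Nullary.Decidable using (⌊_⌋; isYes≗does; dec-true; dec-false; toSum; map′)
open import Relation.Nullary.Reflects using (Reflects; ofʸ; ofⁿ; _×-reflects_; _⊎-reflects_)
open import Relation.Binary.Definitions using (tri<; tri≈; tri>)
open import Relation.Binary.PropositionalEquality

open import Defs

module _ {A : Set} where

  sum-map-mono : ∀ {f g : A → ℕ} → (∀ a → f a ≤ g a) → ∀ as → sum (map f as) ≤ sum (map g as)
  sum-map-mono f≤g []       = z≤n
  sum-map-mono f≤g (a ∷ as) = +-mono-≤ (f≤g a) (sum-map-mono f≤g as)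

  sum-map-cong : ∀ {f g : A → ℕ} → (∀ a → f a ≡ g a) → ∀ as → sum (map f as) ≡ sum (map g as)
  sum-map-cong f≡g as = cong sum (map-cong f≡g as)

  sum-map-+ : ∀ (f g : A → ℕ) as → sum (map (λ a → f a + g a) as) ≡ sum (map f as) + sum (map g as)
  sum-map-+ f g []       = refl
  sum-map-+ f g (a ∷ as) = trans (cong ((f a + g a) +_) (sum-map-+ f g as))
                                 (interchange +-commutativeSemigroup (f a) (g a) _ _)

  sum-map-concatMap : ∀ (h : ℕ → ℕ) (F : A → List ℕ) as →
    sum (map h (concatMap F as)) ≡ sum (map (λ a → sum (map h (F a))) as)
  sum-map-concatMap h F []       = refl
  sum-map-concatMap h F (a ∷ as) = begin
    sum (map h (F a ++ concatMap F as))
      ≡⟨ cong sum (map-++ h (F a) (concatMap F as)) ⟩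
    sum (map h (F a) ++ map h (concatMap F as))
      ≡⟨ sum-++ (map h (F a)) _ ⟩
    sum (map h (F a)) + sum (map h (concatMap F as))
      ≡⟨ cong (sum (map h (F a)) +_) (sum-map-concatMap h F as) ⟩
    sum (map h (F a)) + sum (map (λ a → sum (map h (F a))) as) ∎
    where open ≡-Reasoning

∑ : ∀ {n} → (Fin n → ℕ) → ℕ
∑ {n} f = sum (map f (allFin n))

∑-tabulate : ∀ {n} (f : Fin n → ℕ) → ∑ f ≡ sum (tabulate f)
∑-tabulate f = cong sum (map-tabulate id f)

sum-tabulate-zero : ∀ {n} (f : Fin n → ℕ) → (∀ i → f i ≡ 0) → sum (tabulate f) ≡ 0
sum-tabulate-zero {zero}  f f≡0 = refl
sum-tabulate-zero {suc n} f f≡0 = cong₂ _+_ (f≡0 zero) (sum-tabulate-zero (λ i → f (suc i)) (λ i → f≡0 (suc i)))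

sum-tabulate-point : ∀ {n} (b : Fin n) (f : Fin n → ℕ) → (∀ i → i ≢ b → f i ≡ 0) → sum (tabulate f) ≡ f b
sum-tabulate-point zero    f f≡0 =
  trans (cong (f zero +_) (sum-tabulate-zero (λ i → f (suc i)) (λ i → f≡0 (suc i) λ ())))
        (+-identityʳ (f zero))
sum-tabulate-point (suc b) f f≡0 =
  cong₂ _+_ (f≡0 zero λ ())
            (sum-tabulate-point b (λ i → f (suc i)) (λ i i≢b → f≡0 (suc i) (i≢b ∘′ Fin.suc-injective)))

∑-zero : ∀ {n} (f : Fin n → ℕ) → (∀ i → f i ≡ 0) → ∑ f ≡ 0
∑-zero f f≡0 = trans (∑-tabulate f) (sum-tabulate-zero f f≡0)

∑-point : ∀ {n} (b : Fin n) (f : Fin n → ℕ) → (∀ i → i ≢ b → f i ≡ 0) → ∑ f ≡ f b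
∑-point b f f≡0 = trans (∑-tabulate f) (sum-tabulate-point b f f≡0)

ind : Bool → ℕ
ind b = if b then 1 else 0

δ : ∀ {n} → Fin n → Fin n → ℕ
δ i a = ind ⌊ i ≟ a ⌋

δ-self : ∀ {n} (a : Fin n) → δ a a ≡ 1
δ-self a with a ≟ a
... | yes _   = refl
... | no a≢a = contradiction refl a≢a

δ-≢ : ∀ {n} {i a : Fin n} → i ≢ a → δ i a ≡ 0
δ-≢ {i = i} {a} i≢a with i ≟ a
... | yes i≡a = contradiction i≡a i≢a
... | no _    = refl

∑-δ : ∀ {n} (a : Fin n) → ∑ (λ i → δ i a) ≡ 1
∑-δ a = trans (∑-point a (λ i → δ i a) (λ _ → δ-≢)) (δ-self a)

module Neighbours where
  open import Data.List.Relation.Unary.All using ([]; _∷_)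
  open import Data.List.Relation.Unary.AllPairs using ([]; _∷_)

  multiplicity : ∀ {n} → Fin n → List (Fin n) → ℕ
  multiplicity w vs = sum (map (δ w) vs)

  ∑-multiplicity : ∀ {n} (vs : List (Fin n)) → ∑ (λ w → multiplicity w vs) ≡ length vs
  ∑-multiplicity {n} []   = ∑-zero {n} (λ w → multiplicity w []) (λ _ → refl)
  ∑-multiplicity (a ∷ vs) = begin
    ∑ (λ w → δ w a + multiplicity w vs)          ≡⟨ sum-map-+ (λ w → δ w a) (λ w → multiplicity w vs) (allFin _) ⟩
    ∑ (λ w → δ w a) + ∑ (λ w → multiplicity w vs) ≡⟨ cong₂ _+_ (∑-δ a) (∑-multiplicity vs) ⟩
    suc (length vs)                               ∎
    where open ≡-Reasoning

  multiplicity-absent : ∀ {n} {w : Fin n} {vs} → All (w ≢_) vs → multiplicity w vs ≡ 0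
  multiplicity-absent []          = refl
  multiplicity-absent (w≢a ∷ w∉) = cong₂ _+_ (δ-≢ w≢a) (multiplicity-absent w∉)

  module _ {n} (G : Adj n) where

    multiplicity≤ind : ∀ {v w : Fin n} {vs} → Unique vs → All (λ a → G v a ≡ true) vs →
                       multiplicity w vs ≤ ind (G v w)
    multiplicity≤ind []                   []           = z≤n
    multiplicity≤ind {w = w} {a ∷ vs} (a∉ ∷ uniq) (va ∷ nbrs) with w ≟ a
    ... | yes refl rewrite va | multiplicity-absent a∉ = ≤-refl
    ... | no _     = multiplicity≤ind uniq nbrs

    length≤deg : ∀ {v : Fin n} {vs} → Unique vs → All (λ a → G v a ≡ true) vs → length vs ≤ deg G v
    length≤deg {v} {vs} uniq nbrs = begin
      length vs                      ≡⟨ ∑-multiplicity vs ⟨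
      ∑ (λ w → multiplicity w vs)    ≤⟨ sum-map-mono (λ w → multiplicity≤ind uniq nbrs) (allFin n) ⟩
      deg G v                        ∎
      where open ≤-Reasoning

    deg≡1⇒neighbour-unique : ∀ {v a b : Fin n} → deg G v ≡ 1 → G v a ≡ true → G v b ≡ true → a ≡ b
    deg≡1⇒neighbour-unique {a = a} {b} deg≡1 va vb with a ≟ b
    ... | yes a≡b = a≡b
    ... | no a≢b  = contradiction (subst (2 ≤_) deg≡1 (length≤deg ((a≢b ∷ []) ∷ [] ∷ []) (va ∷ vb ∷ [])))
                                  λ { (s≤s ()) }

    deg≤2⇒third-neighbour : ∀ {v a b c : Fin n} → deg G v ≤ 2 → G v a ≡ true → G v b ≡ true → a ≢ b →
                            G v c ≡ true → c ≡ a ⊎ c ≡ b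
    deg≤2⇒third-neighbour {a = a} {b} {c} deg≤2 va vb a≢b vc with c ≟ a | c ≟ b
    ... | yes c≡a | _       = inj₁ c≡a
    ... | no _    | yes c≡b = inj₂ c≡b
    ... | no c≢a  | no c≢b  = contradiction
      (≤-trans (length≤deg ((a≢b ∷ (c≢a ∘′ sym) ∷ []) ∷ ((c≢b ∘′ sym) ∷ []) ∷ [] ∷ [])
                           (va ∷ vb ∷ vc ∷ []))
               deg≤2)
      λ { (s≤s (s≤s ())) }

open Neighbours

lastOf-∈ : ∀ {A : Set} (a : A) as → lastOf a as ∈ a ∷ as
lastOf-∈ a []       = here refl
lastOf-∈ a (b ∷ bs) = there (lastOf-∈ b bs)

module PendentPaths {n} (G : Adj n) (G-sym : ∀ i j → G i j ≡ G j i) where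
  open import Data.List.Relation.Unary.AllPairs using (_∷_)
  open import Data.List.Relation.Unary.All using (_∷_)

  adj-sym : ∀ {a b} → G a b ≡ true → G b a ≡ true
  adj-sym {a} {b} ab = trans (G-sym b a) ab

  tail-deg≤2 : ∀ {a as} → Tail G a as → deg G a ≤ 2
  tail-deg≤2 {as = []}    deg≡1       = ≤-trans (≤-reflexive deg≡1) (s≤s z≤n)
  tail-deg≤2 {as = _ ∷ _} (deg≡2 , _) = ≤-reflexive deg≡2

  last-deg≡1 : ∀ {a} as → Tail G a as → deg G (lastOf a as) ≡ 1
  last-deg≡1 []       deg≡1       = deg≡1
  last-deg≡1 (_ ∷ as) (_ , _ , t) = last-deg≡1 as t

  last-neighbour : ∀ {p a} as → 2 ≤ deg G p → G p a ≡ true → Tail G a as →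
                   ∃ λ w → G w (lastOf a as) ≡ true × 2 ≤ deg G w × w ∈ p ∷ a ∷ as
  last-neighbour {p} []       2≤p pa _ = p , pa , 2≤p , here refl
  last-neighbour (b ∷ bs) _ _ (deg≡2 , ab , t) with last-neighbour bs (≤-reflexive (sym deg≡2)) ab t
  ... | w , w-last , 2≤w , w∈ = w , w-last , 2≤w , there w∈

  tail-unique : ∀ {p a as bs} → G a p ≡ true → Tail G a as → Tail G a bs →
                Unique (p ∷ a ∷ as) → Unique (p ∷ a ∷ bs) → as ≡ bs
  tail-unique {as = []}     {[]}      _ _           _           _ _ = refl
  tail-unique {as = []}     {_ ∷ _}   _ deg≡1       (deg≡2 , _) _ _ = contradiction (trans (sym deg≡1) deg≡2) λ ()
  tail-unique {as = _ ∷ _}  {[]}      _ (deg≡2 , _) deg≡1       _ _ = contradiction (trans (sym deg≡1) deg≡2) λ ()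
  tail-unique {as = c ∷ cs} {c′ ∷ cs′} ap (deg≡2 , ac , t) (_ , ac′ , t′)
              ((_ ∷ p≢c ∷ _) ∷ uniq) ((_ ∷ p≢c′ ∷ _) ∷ uniq′)
    with deg≤2⇒third-neighbour G (≤-reflexive deg≡2) ap ac p≢c ac′
  ... | inj₁ c′≡p  = contradiction (sym c′≡p) p≢c′
  ... | inj₂ refl = cong (c ∷_) (tail-unique (adj-sym ac) t t′ uniq uniq′)

  3≰2 : ∀ {m} → 3 ≤ m → m ≤ 2 → ⊥
  3≰2 3≤m m≤2 with ≤-trans 3≤m m≤2
  ... | s≤s (s≤s ())

  predecessor-is-hub : ∀ {u x p as} → 3 ≤ deg G u → G u x ≡ true → deg G x ≤ 2 →
                       G p x ≡ true → Tail G x as → Unique (p ∷ x ∷ as) → p ≡ u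
  predecessor-is-hub {as = []} _ ux _ px deg≡1 _ = deg≡1⇒neighbour-unique G deg≡1 (adj-sym px) (adj-sym ux)
  predecessor-is-hub {as = a ∷ _} 3≤u ux x≤2 px (_ , xa , t) ((_ ∷ p≢a ∷ _) ∷ _)
    with deg≤2⇒third-neighbour G x≤2 (adj-sym px) xa p≢a (adj-sym ux)
  ... | inj₁ u≡p  = sym u≡p
  ... | inj₂ refl = ⊥-elim (3≰2 3≤u (tail-deg≤2 t))

  hub-edge-on-tail : ∀ {u x p a as} → 3 ≤ deg G u → G u x ≡ true → deg G x ≤ 2 →
                     G p a ≡ true → Tail G a as → Unique (p ∷ a ∷ as) → x ∈ a ∷ as → p ≡ u × a ≡ x
  hub-edge-on-tail 3≤u ux x≤2 pa t uniq (here refl) = predecessor-is-hub 3≤u ux x≤2 pa t uniq , refl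
  hub-edge-on-tail {as = _ ∷ _} 3≤u ux x≤2 _ (deg≡2 , ab , t) (_ ∷ uniq) (there x∈)
    with hub-edge-on-tail 3≤u ux x≤2 ab t uniq x∈
  ... | refl , _ = ⊥-elim (3≰2 3≤u (≤-reflexive deg≡2))

  paths-through-first-vertex : ∀ {u x v z ps qs} → IsPendentPath G u x ps → IsPendentPath G v z qs →
                               x ∈ v ∷ z ∷ qs → v ≡ u × z ≡ x × qs ≡ ps
  paths-through-first-vertex (_ , _ , tP , _) (3≤v , _ , _ , _) (here refl) =
    ⊥-elim (3≰2 3≤v (tail-deg≤2 tP))
  paths-through-first-vertex (3≤u , ux , tP , uP) (_ , vz , tQ , uQ) (there x∈)
    with hub-edge-on-tail 3≤u ux (tail-deg≤2 tP) vz tQ uQ x∈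
  ... | refl , refl = refl , refl , tail-unique (adj-sym ux) tQ tP uQ uP

data SameEdge {n} (a b : Fin n) : Fin n → Fin n → Set where
  same    : SameEdge a b a b
  swapped : SameEdge a b b a

isYes-reflects : ∀ {A : Set} (a? : Dec A) → Reflects A ⌊ a? ⌋
isYes-reflects (yes a) = ofʸ a
isYes-reflects (no ¬a) = ofⁿ ¬a

sameEdge? : ∀ {n} (a b c d : Fin n) → Dec (SameEdge a b c d)
sameEdge? a b c d = map′ fromPairs toPairs (sameEdge a b c d because
  ((isYes-reflects (a ≟ c) ×-reflects isYes-reflects (b ≟ d)) ⊎-reflects
   (isYes-reflects (a ≟ d) ×-reflects isYes-reflects (b ≟ c))))
  where
  fromPairs : (a ≡ c × b ≡ d) ⊎ (a ≡ d × b ≡ c) → SameEdge a b c d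
  fromPairs (inj₁ (refl , refl)) = same
  fromPairs (inj₂ (refl , refl)) = swapped
  toPairs : SameEdge a b c d → (a ≡ c × b ≡ d) ⊎ (a ≡ d × b ≡ c)
  toPairs same    = inj₁ (refl , refl)
  toPairs swapped = inj₂ (refl , refl)

sameEdge-true : ∀ {n} {a b c d : Fin n} → SameEdge a b c d → sameEdge a b c d ≡ true
sameEdge-true = dec-true (sameEdge? _ _ _ _)

sameEdge-false : ∀ {n} {a b c d : Fin n} → ¬ SameEdge a b c d → sameEdge a b c d ≡ false
sameEdge-false = dec-false (sameEdge? _ _ _ _)

SameEdge-swap : ∀ {n} {a b c d : Fin n} → SameEdge a b c d → SameEdge b a c d
SameEdge-swap same    = swapped
SameEdge-swap swapped = same

SameEdge-shared : ∀ {n} {i j a b c d : Fin n} → SameEdge i j a b → SameEdge i j c d →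
                  (c ≡ a ⊎ c ≡ b) × (d ≡ a ⊎ d ≡ b)
SameEdge-shared same    same    = inj₁ refl , inj₂ refl
SameEdge-shared same    swapped = inj₂ refl , inj₁ refl
SameEdge-shared swapped same    = inj₂ refl , inj₁ refl
SameEdge-shared swapped swapped = inj₁ refl , inj₂ refl

SameEdge-resp : ∀ {n} {A : Set} (F : Fin n → Fin n → A) → (∀ i j → F i j ≡ F j i) →
                ∀ {a b c d} → SameEdge a b c d → F a b ≡ F c d
SameEdge-resp F F-sym same    = refl
SameEdge-resp F F-sym swapped = F-sym _ _

isYes-true : ∀ {A : Set} (a? : Dec A) → A → ⌊ a? ⌋ ≡ true
isYes-true a? a = trans (isYes≗does a?) (dec-true a? a)

isYes-false : ∀ {A : Set} (a? : Dec A) → ¬ A → ⌊ a? ⌋ ≡ false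
isYes-false a? ¬a = trans (isYes≗does a?) (dec-false a? ¬a)

ordered : ∀ {n} → Fin n → Fin n → Bool
ordered i j = ⌊ toℕ i <? toℕ j ⌋

∑pairs : ∀ {n} → (Fin n → Fin n → ℕ) → ℕ
∑pairs F = ∑ λ i → ∑ λ j → if ordered i j then F i j else 0

∑pairs-cong : ∀ {n} {F F′ : Fin n → Fin n → ℕ} → (∀ i j → F i j ≡ F′ i j) → ∑pairs F ≡ ∑pairs F′
∑pairs-cong {n} {F} {F′} F≡F′ = sum-map-cong (λ i → sum-map-cong (masked-cong i) (allFin n)) (allFin n)
  where
  masked-cong : ∀ i j → (if ordered i j then F i j else 0) ≡ (if ordered i j then F′ i j else 0)
  masked-cong i j = cong (λ v → if ordered i j then v else 0) (F≡F′ i j)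

∑pairs-mono : ∀ {n} {F F′ : Fin n → Fin n → ℕ} → (∀ i j → F i j ≤ F′ i j) → ∑pairs F ≤ ∑pairs F′
∑pairs-mono {n} {F} {F′} F≤F′ = sum-map-mono (λ i → sum-map-mono (λ j → masked-mono i j) (allFin n)) (allFin n)
  where
  masked-mono : ∀ i j → (if ordered i j then F i j else 0) ≤ (if ordered i j then F′ i j else 0)
  masked-mono i j with ordered i j
  ... | true  = F≤F′ i j
  ... | false = z≤n

∑pairs-+ : ∀ {n} (F F′ : Fin n → Fin n → ℕ) → ∑pairs (λ i j → F i j + F′ i j) ≡ ∑pairs F + ∑pairs F′
∑pairs-+ {n} F F′ = begin
  ∑pairs (λ i j → F i j + F′ i j)
    ≡⟨ sum-map-cong (λ i → trans (sum-map-cong (masked-+ i) (allFin n)) (sum-map-+ _ _ (allFin n))) (allFin n) ⟩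
  ∑ (λ i → ∑ (λ j → if ordered i j then F i j else 0) + ∑ (λ j → if ordered i j then F′ i j else 0))
    ≡⟨ sum-map-+ _ _ (allFin n) ⟩
  ∑pairs F + ∑pairs F′ ∎
  where
  open ≡-Reasoning
  masked-+ : ∀ i j → (if ordered i j then F i j + F′ i j else 0) ≡
                     (if ordered i j then F i j else 0) + (if ordered i j then F′ i j else 0)
  masked-+ i j with ordered i j
  ... | true  = refl
  ... | false = refl

∑∑-point : ∀ {n} (a b : Fin n) (F : Fin n → Fin n → ℕ) → (∀ i j → ¬ (i ≡ a × j ≡ b) → F i j ≡ 0) →
           ∑ (λ i → ∑ (λ j → F i j)) ≡ F a b
∑∑-point a b F F≡0 = begin
  ∑ (λ i → ∑ (λ j → F i j))  ≡⟨ ∑-point a _ (λ i i≢a → ∑-zero (F i) (λ j → F≡0 i j (i≢a ∘′ proj₁))) ⟩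
  ∑ (λ j → F a j)             ≡⟨ ∑-point b (F a) (λ j j≢b → F≡0 a j (j≢b ∘′ proj₂)) ⟩
  F a b                       ∎
  where open ≡-Reasoning

edgeMass : ∀ {n} → Fin n → Fin n → ℕ → Fin n → Fin n → ℕ
edgeMass a b K i j = if sameEdge i j a b then K else 0

edgeMass-on : ∀ {n} {a b i j : Fin n} {K} → SameEdge i j a b → edgeMass a b K i j ≡ K
edgeMass-on ij≡ab rewrite sameEdge-true ij≡ab = refl

edgeMass-off : ∀ {n} {a b i j : Fin n} {K} → ¬ SameEdge i j a b → edgeMass a b K i j ≡ 0
edgeMass-off ij≢ab rewrite sameEdge-false ij≢ab = refl

SameEdge-flip : ∀ {n} {a b c d : Fin n} → SameEdge a b c d → SameEdge a b d c
SameEdge-flip same    = swapped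
SameEdge-flip swapped = same

∑pairs-edgeMass-< : ∀ {n} {a b : Fin n} K → toℕ a < toℕ b → ∑pairs (edgeMass a b K) ≡ K
∑pairs-edgeMass-< {a = a} {b} K a<b = begin
  ∑pairs (edgeMass a b K)                           ≡⟨ ∑∑-point a b _ off-ab ⟩
  (if ordered a b then edgeMass a b K a b else 0)
    ≡⟨ cong (λ o → if o then edgeMass a b K a b else 0) (isYes-true (toℕ a <? toℕ b) a<b) ⟩
  edgeMass a b K a b                                 ≡⟨ edgeMass-on {a = a} {b} same ⟩
  K                                                  ∎
  where
  open ≡-Reasoning
  off-ab : ∀ i j → ¬ (i ≡ a × j ≡ b) → (if ordered i j then edgeMass a b K i j else 0) ≡ 0
  off-ab i j ij≢ab with sameEdge? i j a b
  ... | no ij≢ab′ rewrite edgeMass-off {K = K} ij≢ab′ with ordered i j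
  ...   | true  = refl
  ...   | false = refl
  off-ab i j ij≢ab | yes same    = contradiction (refl , refl) ij≢ab
  off-ab i j ij≢ab | yes swapped
    rewrite isYes-false (toℕ b <? toℕ a) (<-asym a<b) = refl

∑pairs-edgeMass : ∀ {n} {a b : Fin n} K → a ≢ b → ∑pairs (edgeMass a b K) ≡ K
∑pairs-edgeMass {a = a} {b} K a≢b with <-cmp (toℕ a) (toℕ b)
... | tri< a<b _ _ = ∑pairs-edgeMass-< K a<b
... | tri≈ _ a≡b _ = contradiction (Fin.toℕ-injective a≡b) a≢b
... | tri> _ _ b<a = trans (∑pairs-cong flip) (∑pairs-edgeMass-< K b<a)
  where
  flip : ∀ i j → edgeMass a b K i j ≡ edgeMass b a K i j
  flip i j with sameEdge? i j a b
  ... | yes ij≡ab = trans (edgeMass-on ij≡ab) (sym (edgeMass-on (SameEdge-flip ij≡ab)))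
  ... | no ij≢ab  = trans (edgeMass-off ij≢ab) (sym (edgeMass-off (ij≢ab ∘′ SameEdge-flip)))

radicand : ∀ {n} → (Fin n → ℕ) → Fin n → Fin n → ℕ
radicand d i j = d i * d i + d j * d j

edgeValue : ∀ {n} → Adj n → (Fin n → ℕ) → (ℕ → ℕ) → Fin n → Fin n → ℕ
edgeValue H d h i j = if H i j then h (radicand d i j) else 0

edgeValue-on : ∀ {n} (H : Adj n) e h i j → H i j ≡ true → edgeValue H e h i j ≡ h (radicand e i j)
edgeValue-on H e h i j Hij rewrite Hij = refl

edgeValue-off : ∀ {n} (H : Adj n) e h i j → H i j ≡ false → edgeValue H e h i j ≡ 0
edgeValue-off H e h i j Hij rewrite Hij = refl

radicand-resp : ∀ {n} (e : Fin n → ℕ) {i j a b} → SameEdge i j a b → radicand e i j ≡ radicand e a b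
radicand-resp e = SameEdge-resp (radicand e) (λ i j → +-comm (e i * e i) (e j * e j))

edgeValue-at : ∀ {n} (H : Adj n) e h i j {a b} → SameEdge i j a b → H i j ≡ true →
               edgeValue H e h i j ≡ h (radicand e a b)
edgeValue-at H e h i j ij≡ab Hij = trans (edgeValue-on H e h i j Hij) (cong h (radicand-resp e ij≡ab))

edgeValue-mono : ∀ {n} (H H′ : Adj n) e e′ h i j → H′ i j ≡ H i j →
                 (H i j ≡ true → h (radicand e′ i j) ≤ h (radicand e i j)) →
                 edgeValue H′ e′ h i j ≤ edgeValue H e h i j
edgeValue-mono H H′ e e′ h i j H′≡H le rewrite H′≡H with H i j
... | true  = le refl
... | false = z≤n

sum-map-soTerms : ∀ {n} (H : Adj n) (h : ℕ → ℕ) → sum (map h (soTerms H)) ≡ ∑pairs (edgeValue H (deg H) h)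
sum-map-soTerms {n} H h = trans (sum-map-concatMap h _ (allFin n)) (sum-map-cong row (allFin n))
  where
  entries : Fin n → Fin n → List ℕ
  entries i j = if ordered i j ∧ H i j then radicand (deg H) i j ∷ [] else []
  entry : ∀ i j → sum (map h (entries i j)) ≡ (if ordered i j then edgeValue H (deg H) h i j else 0)
  entry i j with ordered i j | H i j
  ... | true  | true  = +-identityʳ _
  ... | true  | false = refl
  ... | false | _     = refl
  row : ∀ i → sum (map h (concatMap (entries i) (allFin n)))
            ≡ ∑ (λ j → if ordered i j then edgeValue H (deg H) h i j else 0)
  row i = trans (sum-map-concatMap h (entries i) (allFin n)) (sum-map-cong (entry i) (allFin n))

module _ {n} (G : Adj n) (u x y : Fin n) where

  delAdd-removed : ∀ {s t} → SameEdge s t u x → delAdd G u x y s t ≡ false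
  delAdd-removed st≡ux rewrite sameEdge-true st≡ux = refl

  delAdd-added : ∀ {s t} → ¬ SameEdge s t u x → SameEdge s t x y → delAdd G u x y s t ≡ true
  delAdd-added st≢ux st≡xy rewrite sameEdge-false st≢ux | sameEdge-true st≡xy = refl

  delAdd-other : ∀ {s t} → ¬ SameEdge s t u x → ¬ SameEdge s t x y → delAdd G u x y s t ≡ G s t
  delAdd-other st≢ux st≢xy rewrite sameEdge-false st≢ux | sameEdge-false st≢xy = refl

adjacent⇒≢ : ∀ {n} {G : Adj n} → IsSimple G → ∀ {a b} → G a b ≡ true → a ≢ b
adjacent⇒≢ (_ , G-loopless) {a} ab refl = contradiction (trans (sym ab) (G-loopless a)) λ ()

module Rewiring {n} (G : Adj n) (simple : IsSimple G) {u x y : Fin n}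
                (ux : G u x ≡ true) (xy : G x y ≡ false) (u≢y : u ≢ y) (x≢y : x ≢ y) where

  G′ : Adj n
  G′ = delAdd G u x y

  private
    G-sym : ∀ i j → G i j ≡ G j i
    G-sym = proj₁ simple

    u≢x : u ≢ x
    u≢x = adjacent⇒≢ simple ux

    edge-resp : ∀ {i j a b} → SameEdge i j a b → G i j ≡ G a b
    edge-resp = SameEdge-resp G G-sym

    xs≢ux : ∀ {s} → s ≢ u → ¬ SameEdge x s u x
    xs≢ux s≢u same    = u≢x refl
    xs≢ux s≢u swapped = s≢u refl

    ys≢ux : ∀ {s} → ¬ SameEdge y s u x
    ys≢ux same    = u≢y refl
    ys≢ux swapped = x≢y refl

    -- `toSum` stops `with` from also abstracting the `s ≟ u` hidden inside `sameEdge`.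
    ind-x : ∀ s → ind (G′ x s) + δ s u ≡ ind (G x s) + δ s y
    ind-x s with toSum (s ≟ u) | toSum (s ≟ y)
    ... | inj₁ refl | inj₁ refl = ⊥-elim (u≢y refl)
    ... | inj₁ refl | inj₂ s≢y
      rewrite delAdd-removed G u x y swapped | trans (G-sym x u) ux | δ-self u | δ-≢ s≢y = refl
    ... | inj₂ s≢u  | inj₁ refl
      rewrite delAdd-added G u x y (xs≢ux s≢u) same | xy | δ-≢ s≢u | δ-self y = refl
    ... | inj₂ s≢u  | inj₂ s≢y
      rewrite delAdd-other G u x y (xs≢ux s≢u) (λ { same → s≢y refl ; swapped → x≢y refl })
            | δ-≢ s≢u | δ-≢ s≢y = refl

    ind-y : ∀ s → ind (G′ y s) ≡ ind (G y s) + δ s x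
    ind-y s with toSum (s ≟ x)
    ... | inj₁ refl
      rewrite delAdd-added G u x y ys≢ux swapped | trans (G-sym y x) xy | δ-self x = refl
    ... | inj₂ s≢x
      rewrite delAdd-other G u x y {t = s} ys≢ux (λ { same → x≢y refl ; swapped → s≢x refl })
            | δ-≢ s≢x = sym (+-identityʳ _)

    ind-≤ : ∀ {t} s → t ≢ x → t ≢ y → ind (G′ t s) ≤ ind (G t s)
    ind-≤ {t} s t≢x t≢y with sameEdge? t s u x
    ... | yes ts≡ux rewrite delAdd-removed G u x y ts≡ux = z≤n
    ... | no ts≢ux
      rewrite delAdd-other G u x y ts≢ux (λ { same → t≢x refl ; swapped → t≢y refl }) = ≤-refl

  deg-x : deg G′ x ≡ deg G x
  deg-x = +-cancelʳ-≡ _ _ _ (begin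
    deg G′ x + 1                              ≡⟨ cong (deg G′ x +_) (∑-δ u) ⟨
    deg G′ x + ∑ (λ s → δ s u)                ≡⟨ sum-map-+ (λ s → ind (G′ x s)) (λ s → δ s u) (allFin n) ⟨
    ∑ (λ s → ind (G′ x s) + δ s u)            ≡⟨ sum-map-cong ind-x (allFin n) ⟩
    ∑ (λ s → ind (G x s) + δ s y)             ≡⟨ sum-map-+ (λ s → ind (G x s)) (λ s → δ s y) (allFin n) ⟩
    deg G x + ∑ (λ s → δ s y)                 ≡⟨ cong (deg G x +_) (∑-δ y) ⟩
    deg G x + 1                               ∎)
    where open ≡-Reasoning

  deg-y : deg G′ y ≡ deg G y + 1
  deg-y = begin
    deg G′ y                         ≡⟨ sum-map-cong ind-y (allFin n) ⟩
    ∑ (λ s → ind (G y s) + δ s x)    ≡⟨ sum-map-+ (λ s → ind (G y s)) (λ s → δ s x) (allFin n) ⟩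
    deg G y + ∑ (λ s → δ s x)        ≡⟨ cong (deg G y +_) (∑-δ x) ⟩
    deg G y + 1                      ∎
    where open ≡-Reasoning

  deg-≤ : ∀ {t} → t ≢ y → deg G′ t ≤ deg G t
  deg-≤ {t} t≢y with toSum (t ≟ x)
  ... | inj₁ refl = ≤-reflexive deg-x
  ... | inj₂ t≢x  = sum-map-mono (λ s → ind-≤ s t≢x t≢y) (allFin n)

  module _ {w : Fin n} (wy : G w y ≡ true) (deg-y≡1 : deg G y ≡ 1) (φ : ℕ → ℕ)
           (φ-mono : ∀ {a b} → a ≤ b → φ a ≤ φ b) where

    private
      d d′ : Fin n → ℕ
      d  = deg G
      d′ = deg G′

      w≢x : w ≢ x
      w≢x refl = contradiction (trans (sym wy) xy) λ ()

      neighbour-of-y : ∀ {t} → G y t ≡ true → t ≡ w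
      neighbour-of-y yt = deg≡1⇒neighbour-unique G deg-y≡1 yt (trans (G-sym y w) wy)

      w≢y : w ≢ y
      w≢y = adjacent⇒≢ simple wy

      y∉ux : ∀ {i j c} → SameEdge i j u x → ¬ SameEdge i j c y
      y∉ux ij≡ux ij≡cy with proj₂ (SameEdge-shared ij≡ux ij≡cy)
      ... | inj₁ y≡u = u≢y (sym y≡u)
      ... | inj₂ y≡x = x≢y (sym y≡x)

      w∉xy : ∀ {i j} → SameEdge i j x y → ¬ SameEdge i j w y
      w∉xy ij≡xy ij≡wy with proj₁ (SameEdge-shared ij≡xy ij≡wy)
      ... | inj₁ w≡x = w≢x w≡x
      ... | inj₂ w≡y = w≢y w≡y

      not-at-y : ∀ {i j} → G i j ≡ true → ¬ SameEdge i j w y → i ≢ y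
      not-at-y ij ij≢wy refl with neighbour-of-y ij
      ... | refl = ij≢wy swapped

      φux φwy φ′wy φ′xy : ℕ
      φux = φ (radicand d u x)
      φwy = φ (radicand d w y)
      φ′wy = φ (radicand d′ w y)
      φ′xy = φ (radicand d′ x y)

      F F′ : Fin n → Fin n → ℕ
      F  = edgeValue G d φ
      F′ = edgeValue G′ d′ φ

      other-edge : ∀ {i j} → ¬ SameEdge i j u x → ¬ SameEdge i j x y → ¬ SameEdge i j w y →
                   F′ i j ≤ F i j
      other-edge {i} {j} ij≢ux ij≢xy ij≢wy =
        edgeValue-mono G G′ d d′ φ i j (delAdd-other G u x y ij≢ux ij≢xy) λ ij →
          φ-mono (+-mono-≤ (*-mono-≤ (d′i≤di ij) (d′i≤di ij)) (*-mono-≤ (d′j≤dj ij) (d′j≤dj ij)))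
        where
        d′i≤di : G i j ≡ true → d′ i ≤ d i
        d′i≤di ij = deg-≤ (not-at-y ij ij≢wy)
        d′j≤dj : G i j ≡ true → d′ j ≤ d j
        d′j≤dj ij = deg-≤ (not-at-y (trans (G-sym j i) ij) (ij≢wy ∘′ SameEdge-swap))

      exchange-pointwise : ∀ i j → F′ i j + (edgeMass u x φux i j + edgeMass w y φwy i j)
                                 ≤ F i j + (edgeMass x y φ′xy i j + edgeMass w y φ′wy i j)
      exchange-pointwise i j with sameEdge? i j u x
      ... | yes ij≡ux = ≤-reflexive (begin
        F′ i j + (edgeMass u x φux i j + edgeMass w y φwy i j)
          ≡⟨ cong₂ _+_ (edgeValue-off G′ d′ φ i j (delAdd-removed G u x y ij≡ux))
                       (cong₂ _+_ (edgeMass-on ij≡ux) (edgeMass-off (y∉ux ij≡ux))) ⟩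
        φux + 0
          ≡⟨ cong₂ _+_ (edgeValue-at G d φ i j ij≡ux (trans (edge-resp ij≡ux) ux))
                       (cong₂ _+_ (edgeMass-off (y∉ux ij≡ux)) (edgeMass-off (y∉ux ij≡ux))) ⟨
        F i j + (edgeMass x y φ′xy i j + edgeMass w y φ′wy i j) ∎)
        where open ≡-Reasoning
      ... | no ij≢ux with sameEdge? i j x y
      ...   | yes ij≡xy = ≤-reflexive (begin
        F′ i j + (edgeMass u x φux i j + edgeMass w y φwy i j)
          ≡⟨ cong₂ _+_ (edgeValue-at G′ d′ φ i j ij≡xy (delAdd-added G u x y ij≢ux ij≡xy))
                       (cong₂ _+_ (edgeMass-off ij≢ux) (edgeMass-off (w∉xy ij≡xy))) ⟩
        φ′xy + 0
          ≡⟨ cong₂ _+_ (edgeValue-off G d φ i j (trans (edge-resp ij≡xy) xy))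
                       (cong₂ _+_ (edgeMass-on ij≡xy) (edgeMass-off (w∉xy ij≡xy))) ⟨
        F i j + (edgeMass x y φ′xy i j + edgeMass w y φ′wy i j) ∎)
        where open ≡-Reasoning
      ...   | no ij≢xy with sameEdge? i j w y
      ...     | yes ij≡wy = ≤-reflexive (begin
        F′ i j + (edgeMass u x φux i j + edgeMass w y φwy i j)
          ≡⟨ cong₂ _+_ (edgeValue-at G′ d′ φ i j ij≡wy (trans (delAdd-other G u x y ij≢ux ij≢xy) ij))
                       (cong₂ _+_ (edgeMass-off ij≢ux) (edgeMass-on ij≡wy)) ⟩
        φ′wy + φwy
          ≡⟨ +-comm φ′wy φwy ⟩
        φwy + φ′wy
          ≡⟨ cong₂ _+_ (edgeValue-at G d φ i j ij≡wy ij)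
                       (cong₂ _+_ (edgeMass-off ij≢xy) (edgeMass-on ij≡wy)) ⟨
        F i j + (edgeMass x y φ′xy i j + edgeMass w y φ′wy i j) ∎)
        where
        open ≡-Reasoning
        ij : G i j ≡ true
        ij = trans (edge-resp ij≡wy) wy
      ...     | no ij≢wy = begin
        F′ i j + (edgeMass u x φux i j + edgeMass w y φwy i j)
          ≡⟨ cong (F′ i j +_) (cong₂ _+_ (edgeMass-off ij≢ux) (edgeMass-off ij≢wy)) ⟩
        F′ i j + 0
          ≤⟨ +-monoˡ-≤ 0 (other-edge ij≢ux ij≢xy ij≢wy) ⟩
        F i j + 0
          ≡⟨ cong (F i j +_) (cong₂ _+_ (edgeMass-off ij≢xy) (edgeMass-off ij≢wy)) ⟨
        F i j + (edgeMass x y φ′xy i j + edgeMass w y φ′wy i j) ∎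
        where open ≤-Reasoning

    exchange : ∑pairs (edgeValue G′ (deg G′) φ) + (φ (radicand (deg G) u x) + φ (radicand (deg G) w y))
             ≤ ∑pairs (edgeValue G (deg G) φ) + (φ (radicand (deg G′) x y) + φ (radicand (deg G′) w y))
    exchange = begin
      ∑pairs F′ + (φux + φwy)
        ≡⟨ cong (∑pairs F′ +_) (cong₂ _+_ (∑pairs-edgeMass φux u≢x) (∑pairs-edgeMass φwy w≢y)) ⟨
      ∑pairs F′ + (∑pairs (edgeMass u x φux) + ∑pairs (edgeMass w y φwy))
        ≡⟨ ∑pairs-+-+ F′ (edgeMass u x φux) (edgeMass w y φwy) ⟨
      ∑pairs (λ i j → F′ i j + (edgeMass u x φux i j + edgeMass w y φwy i j))
        ≤⟨ ∑pairs-mono exchange-pointwise ⟩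
      ∑pairs (λ i j → F i j + (edgeMass x y φ′xy i j + edgeMass w y φ′wy i j))
        ≡⟨ ∑pairs-+-+ F (edgeMass x y φ′xy) (edgeMass w y φ′wy) ⟩
      ∑pairs F + (∑pairs (edgeMass x y φ′xy) + ∑pairs (edgeMass w y φ′wy))
        ≡⟨ cong (∑pairs F +_) (cong₂ _+_ (∑pairs-edgeMass φ′xy x≢y) (∑pairs-edgeMass φ′wy w≢y)) ⟩
      ∑pairs F + (φ′xy + φ′wy) ∎
      where
      open ≤-Reasoning
      ∑pairs-+-+ : ∀ A B C → ∑pairs (λ i j → A i j + (B i j + C i j)) ≡ ∑pairs A + (∑pairs B + ∑pairs C)
      ∑pairs-+-+ A B C = trans (∑pairs-+ A _) (cong (∑pairs A +_) (∑pairs-+ B C))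

isqrt : ℕ → ℕ
isqrt zero = zero
isqrt (suc N) with suc (isqrt N) * suc (isqrt N) ≤? suc N
... | yes _ = suc (isqrt N)
... | no  _ = isqrt N

isqrt-sq≤ : ∀ N → isqrt N * isqrt N ≤ N
isqrt-sq≤ zero = z≤n
isqrt-sq≤ (suc N) with suc (isqrt N) * suc (isqrt N) ≤? suc N
... | yes s²≤ = s²≤
... | no  _   = m≤n⇒m≤1+n (isqrt-sq≤ N)

<suc-isqrt-sq : ∀ N → N < suc (isqrt N) * suc (isqrt N)
<suc-isqrt-sq zero = s≤s z≤n
<suc-isqrt-sq (suc N) with suc (isqrt N) * suc (isqrt N) ≤? suc N
... | yes _   = ≤-<-trans (<suc-isqrt-sq N) (*-mono-< (n<1+n (suc (isqrt N))) (n<1+n (suc (isqrt N))))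
... | no  s²≰ = ≰⇒> s²≰

isqrt-greatest : ∀ {N t} → t * t ≤ N → t ≤ isqrt N
isqrt-greatest {N} t²≤N = ≮⇒≥ λ s<t → <⇒≱ (<suc-isqrt-sq N) (≤-trans (*-mono-≤ s<t s<t) t²≤N)

isqrt-least : ∀ {N t} → N < suc t * suc t → isqrt N ≤ t
isqrt-least {N} N<t² = ≮⇒≥ λ t<s → <⇒≱ N<t² (≤-trans (*-mono-≤ t<s t<s) (isqrt-sq≤ N))

isqrt-mono : ∀ {N N′} → N ≤ N′ → isqrt N ≤ isqrt N′
isqrt-mono {N} N≤N′ = isqrt-greatest (≤-trans (isqrt-sq≤ N) N≤N′)

isqrt+e≤isqrt : ∀ {A B} R e → A ≤ R * R → A + 2 * e * R + e * e ≤ B → isqrt A + e ≤ isqrt B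
isqrt+e≤isqrt {A} {B} R e A≤R² h = isqrt-greatest (begin
  (s + e) * (s + e)         ≡⟨ square-+ s e ⟩
  s * s + 2 * e * s + e * e  ≤⟨ +-monoˡ-≤ (e * e) (+-mono-≤ (isqrt-sq≤ A) (*-monoʳ-≤ (2 * e) s≤R)) ⟩
  A + 2 * e * R + e * e      ≤⟨ h ⟩
  B                          ∎)
  where
  open ≤-Reasoning
  s : ℕ
  s = isqrt A
  s≤R : s ≤ R
  s≤R = isqrt-least (≤-<-trans A≤R² (*-mono-< (n<1+n R) (n<1+n R)))
  square-+ : ∀ s e → (s + e) * (s + e) ≡ s * s + 2 * e * s + e * e
  square-+ = solve-∀

isqrt≤isqrt+e : ∀ {A B} R e → R * R ≤ A → B ≤ A + 2 * e * R + e * e → isqrt B ≤ isqrt A + e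
isqrt≤isqrt+e {A} {B} R e R²≤A h = isqrt-least (begin-strict
  B                                           ≤⟨ h ⟩
  A + 2 * e * R + e * e
    <⟨ +-mono-<-≤ (+-mono-<-≤ (<suc-isqrt-sq A) (*-monoʳ-≤ (2 * e) R≤s+1)) ≤-refl ⟩
  suc s * suc s + 2 * e * suc s + e * e       ≡⟨ square-+ s e ⟩
  suc (s + e) * suc (s + e)                   ∎)
  where
  open ≤-Reasoning
  s : ℕ
  s = isqrt A
  R≤s+1 : R ≤ suc s
  R≤s+1 = m≤n⇒m≤1+n (isqrt-greatest R²≤A)
  square-+ : ∀ s e → suc s * suc s + 2 * e * suc s + e * e ≡ suc (s + e) * suc (s + e)
  square-+ = solve-∀

scaledSqrt : ℕ → ℕ → ℕ
scaledSqrt M t = isqrt (t * (M * M))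

scaledSqrt-mono : ∀ M {a b} → a ≤ b → scaledSqrt M a ≤ scaledSqrt M b
scaledSqrt-mono M a≤b = isqrt-mono (*-monoˡ-≤ (M * M) a≤b)

-- With M = 10k, the bounds R of the shift lemmas are 29k ≥ M√8 ≥ M√(a + 4) and 22k ≤ M√5 ≤ M√(b + 1).
sqrt-step-up : ∀ k {a d} → a ≤ 4 → 3 ≤ d →
               scaledSqrt (10 * k) (a + 4) + 7 * k ≤ scaledSqrt (10 * k) (d * d + a)
sqrt-step-up k {a} {d} a≤4 3≤d = isqrt+e≤isqrt (29 * k) (7 * k) below above
  where
  open ≤-Reasoning
  M² : ℕ
  M² = 10 * k * (10 * k)
  below : (a + 4) * M² ≤ 29 * k * (29 * k)
  below = begin
    (a + 4) * M²      ≤⟨ *-monoˡ-≤ M² (+-monoˡ-≤ 4 a≤4) ⟩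
    8 * M²            ≡⟨ e₁ k ⟩
    800 * (k * k)     ≤⟨ *-monoˡ-≤ (k * k) (≤ᵇ⇒≤ 800 841 _) ⟩
    841 * (k * k)     ≡⟨ e₂ k ⟩
    29 * k * (29 * k) ∎
    where
    e₁ : ∀ k → 8 * (10 * k * (10 * k)) ≡ 800 * (k * k)
    e₁ = solve-∀
    e₂ : ∀ k → 841 * (k * k) ≡ 29 * k * (29 * k)
    e₂ = solve-∀
  above : (a + 4) * M² + 2 * (7 * k) * (29 * k) + 7 * k * (7 * k) ≤ (d * d + a) * M²
  above = begin
    (a + 4) * M² + 2 * (7 * k) * (29 * k) + 7 * k * (7 * k)
      ≡⟨ e₁ a k ⟩
    (a + 4) * M² + 455 * (k * k)
      ≤⟨ +-monoʳ-≤ ((a + 4) * M²) (*-monoˡ-≤ (k * k) (≤ᵇ⇒≤ 455 500 _)) ⟩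
    (a + 4) * M² + 500 * (k * k)
      ≡⟨ e₂ a k ⟩
    (9 + a) * M²
      ≤⟨ *-monoˡ-≤ M² (+-monoˡ-≤ a (*-mono-≤ 3≤d 3≤d)) ⟩
    (d * d + a) * M² ∎
    where
    e₁ : ∀ a k → (a + 4) * (10 * k * (10 * k)) + 2 * (7 * k) * (29 * k) + 7 * k * (7 * k)
               ≡ (a + 4) * (10 * k * (10 * k)) + 455 * (k * k)
    e₁ = solve-∀
    e₂ : ∀ a k → (a + 4) * (10 * k * (10 * k)) + 500 * (k * k) ≡ (9 + a) * (10 * k * (10 * k))
    e₂ = solve-∀

sqrt-step-down : ∀ k {b} → 4 ≤ b → scaledSqrt (10 * k) (b + 4) ≤ scaledSqrt (10 * k) (b + 1) + 6 * k
sqrt-step-down k {b} 4≤b = isqrt≤isqrt+e (22 * k) (6 * k) below (≤-reflexive (above b k))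
  where
  open ≤-Reasoning
  M² : ℕ
  M² = 10 * k * (10 * k)
  below : 22 * k * (22 * k) ≤ (b + 1) * M²
  below = begin
    22 * k * (22 * k) ≡⟨ e₁ k ⟩
    484 * (k * k)     ≤⟨ *-monoˡ-≤ (k * k) (≤ᵇ⇒≤ 484 500 _) ⟩
    500 * (k * k)     ≡⟨ e₂ k ⟩
    5 * M²            ≤⟨ *-monoˡ-≤ M² (+-monoˡ-≤ 1 4≤b) ⟩
    (b + 1) * M²      ∎
    where
    e₁ : ∀ k → 22 * k * (22 * k) ≡ 484 * (k * k)
    e₁ = solve-∀
    e₂ : ∀ k → 500 * (k * k) ≡ 5 * (10 * k * (10 * k))
    e₂ = solve-∀
  above : ∀ b k → (b + 4) * (10 * k * (10 * k))
                ≡ (b + 1) * (10 * k * (10 * k)) + 2 * (6 * k) * (22 * k) + 6 * k * (6 * k)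
  above = solve-∀

sombor-gap : ∀ k {du dx dw dw′} → 3 ≤ du → dx ≤ 2 → 2 ≤ dw → dw′ ≤ dw →
  scaledSqrt (10 * k) (dx * dx + 4) + scaledSqrt (10 * k) (dw′ * dw′ + 4) + k
    ≤ scaledSqrt (10 * k) (du * du + dx * dx) + scaledSqrt (10 * k) (dw * dw + 1)
sombor-gap k {du} {dx} {dw} {dw′} 3≤du dx≤2 2≤dw dw′≤dw = begin
  φ (dx * dx + 4) + φ (dw′ * dw′ + 4) + k
    ≤⟨ +-monoˡ-≤ k (+-monoʳ-≤ (φ (dx * dx + 4)) (scaledSqrt-mono M (+-monoˡ-≤ 4 (*-mono-≤ dw′≤dw dw′≤dw)))) ⟩
  φ (dx * dx + 4) + φ (dw * dw + 4) + k
    ≤⟨ +-monoˡ-≤ k (+-monoʳ-≤ (φ (dx * dx + 4)) (sqrt-step-down k (*-mono-≤ 2≤dw 2≤dw))) ⟩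
  φ (dx * dx + 4) + (φ (dw * dw + 1) + 6 * k) + k
    ≡⟨ rearrange (φ (dx * dx + 4)) (φ (dw * dw + 1)) k ⟩
  φ (dx * dx + 4) + 7 * k + φ (dw * dw + 1)
    ≤⟨ +-monoˡ-≤ (φ (dw * dw + 1)) (sqrt-step-up k (*-mono-≤ dx≤2 dx≤2) 3≤du) ⟩
  φ (du * du + dx * dx) + φ (dw * dw + 1) ∎
  where
  open ≤-Reasoning
  M : ℕ
  M = 10 * k
  φ : ℕ → ℕ
  φ = scaledSqrt M
  rearrange : ∀ p q k → p + (q + 6 * k) + k ≡ p + 7 * k + q
  rearrange = solve-∀

≤-via-toℚᵘ : ∀ {p q : ℚ} {p′ q′} → toℚᵘ p ℚᵘ.≃ p′ → toℚᵘ q ℚᵘ.≃ q′ → p′ ℚᵘ.≤ q′ → p ℚ.≤ q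
≤-via-toℚᵘ p≃ q≃ p′≤q′ = toℚᵘ-cancel-≤ (≤-respˡ-≃ (≃-sym p≃) (≤-respʳ-≃ (≃-sym q≃) p′≤q′))

<-via-toℚᵘ : ∀ {p q : ℚ} {p′ q′} → toℚᵘ p ℚᵘ.≃ p′ → toℚᵘ q ℚᵘ.≃ q′ → p′ ℚᵘ.< q′ → p ℚ.< q
<-via-toℚᵘ p≃ q≃ p′<q′ = toℚᵘ-cancel-< (<-respˡ-≃ (≃-sym p≃) (<-respʳ-≃ (≃-sym q≃) p′<q′))

mkℚᵘ-≤ : ∀ {a b c d} → a * suc d ≤ b * suc c → mkℚᵘ (ℤ.+ a) c ℚᵘ.≤ mkℚᵘ (ℤ.+ b) d
mkℚᵘ-≤ {a} {b} {c} {d} h = *≤* (subst₂ ℤ._≤_ (pos-* a (suc d)) (pos-* b (suc c)) (+≤+ h))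

mkℚᵘ-< : ∀ {a b c d} → a * suc d < b * suc c → mkℚᵘ (ℤ.+ a) c ℚᵘ.< mkℚᵘ (ℤ.+ b) d
mkℚᵘ-< {a} {b} {c} {d} h = *<* (subst₂ ℤ._<_ (pos-* a (suc d)) (pos-* b (suc c)) (+<+ h))

Pointwise-map : ∀ {A B : Set} {R : A → B → Set} {f : A → B} →
                (∀ a → R a (f a)) → ∀ as → Pointwise R as (map f as)
Pointwise-map Rf []       = Pointwise.[]
Pointwise-map Rf (a ∷ as) = Rf a Pointwise.∷ Pointwise-map Rf as

module Fractions (m : ℕ) where

  frac : ℕ → ℚ
  frac a = ℤ.+ a / suc m

  toℚᵘ-frac : ∀ a → toℚᵘ (frac a) ℚᵘ.≃ mkℚᵘ (ℤ.+ a) m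
  toℚᵘ-frac a = toℚᵘ-fromℚᵘ (mkℚᵘ (ℤ.+ a) m)

  frac-0 : frac 0 ≡ 0ℚ
  frac-0 = toℚᵘ-injective (≃-trans (toℚᵘ-frac 0) (*≡* refl))

  frac-+ : ∀ a b → frac a ℚ.+ frac b ≡ frac (a + b)
  frac-+ a b = toℚᵘ-injective (≃-trans (toℚᵘ-homo-+ (frac a) (frac b))
    (≃-trans (+-cong (toℚᵘ-frac a) (toℚᵘ-frac b)) (≃-trans (*≡* cross) (≃-sym (toℚᵘ-frac (a + b))))))
    where
    M : ℕ
    M = suc m
    distrib : ∀ A B C → (A ℤ.* C ℤ.+ B ℤ.* C) ℤ.* C ≡ (A ℤ.+ B) ℤ.* (C ℤ.* C)
    distrib = ℤ-Ring.solve-∀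
    cross : (ℤ.+ a ℤ.* ℤ.+ M ℤ.+ ℤ.+ b ℤ.* ℤ.+ M) ℤ.* ℤ.+ M ≡ ℤ.+ (a + b) ℤ.* ℤ.+ (M * M)
    cross = trans (distrib (ℤ.+ a) (ℤ.+ b) (ℤ.+ M)) (sym (cong₂ ℤ._*_ (pos-+ a b) (pos-* M M)))

  frac-nonneg : ∀ a → 0ℚ ℚ.≤ frac a
  frac-nonneg a = ≤-via-toℚᵘ ≃-refl (toℚᵘ-frac a) (mkℚᵘ-≤ z≤n)

  frac-< : ∀ {a b} → a < b → frac a ℚ.< frac b
  frac-< {a} {b} a<b = <-via-toℚᵘ (toℚᵘ-frac a) (toℚᵘ-frac b) (mkℚᵘ-< (*-monoˡ-< (suc m) a<b))

  toℚᵘ-frac-sq : ∀ p → toℚᵘ (frac p ℚ.* frac p) ℚᵘ.≃ mkℚᵘ (ℤ.+ (p * p)) (m + m * suc m)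
  toℚᵘ-frac-sq p = ≃-trans (toℚᵘ-homo-* (frac p) (frac p))
    (≃-trans (*-cong (toℚᵘ-frac p) (toℚᵘ-frac p)) (≃-reflexive (cong (λ z → mkℚᵘ z _) (sym (pos-* p p)))))

  frac-sq-≤ : ∀ p a → p * p ≤ a * (suc m * suc m) → frac p ℚ.* frac p ℚ.≤ ℕtoℚ a
  frac-sq-≤ p a h = ≤-via-toℚᵘ (toℚᵘ-frac-sq p) (toℚᵘ-fromℚᵘ (mkℚᵘ (ℤ.+ a) 0))
    (mkℚᵘ-≤ (subst (_≤ a * (suc m * suc m)) (sym (*-identityʳ (p * p))) h))

  frac-sq-≥ : ∀ p a → a * (suc m * suc m) ≤ p * p → ℕtoℚ a ℚ.≤ frac p ℚ.* frac p
  frac-sq-≥ p a h = ≤-via-toℚᵘ (toℚᵘ-fromℚᵘ (mkℚᵘ (ℤ.+ a) 0)) (toℚᵘ-frac-sq p)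
    (mkℚᵘ-≤ (subst (a * (suc m * suc m) ≤_) (sym (*-identityʳ (p * p))) h))

  sumℚ-map-frac : ∀ {A : Set} (f : A → ℕ) as → sumℚ (map (λ a → frac (f a)) as) ≡ frac (sum (map f as))
  sumℚ-map-frac f []       = sym frac-0
  sumℚ-map-frac f (a ∷ as) = trans (cong (frac (f a) ℚ.+_) (sumℚ-map-frac f as)) (frac-+ (f a) _)

  SqrtSumGt-by-scaledSqrt : ∀ as bs →
    sum (map (λ b → suc (scaledSqrt (suc m) b)) bs) < sum (map (scaledSqrt (suc m)) as) → SqrtSumGt as bs
  SqrtSumGt-by-scaledSqrt as bs rounded-sums<
    = map (λ a → frac (φ a)) as , map (λ b → frac (suc (φ b))) bs
    , Pointwise-map (λ a → frac-nonneg (φ a) , frac-sq-≤ (φ a) a (isqrt-sq≤ (a * M²))) as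
    , Pointwise-map (λ b → frac-nonneg (suc (φ b))
                         , frac-sq-≥ (suc (φ b)) b (<⇒≤ (<suc-isqrt-sq (b * M²)))) bs
    , subst₂ ℚ._<_ (sym (sumℚ-map-frac (λ b → suc (φ b)) bs)) (sym (sumℚ-map-frac φ as)) (frac-< rounded-sums<)
    where
    φ : ℕ → ℕ
    φ = scaledSqrt (suc m)
    M² : ℕ
    M² = suc m * suc m

∑pairs-edgeValue-suc : ∀ {n} (H : Adj n) e h →
  ∑pairs (edgeValue H e (λ t → suc (h t))) ≤ ∑pairs (edgeValue H e h) + ∑pairs {n} (λ _ _ → 1)
∑pairs-edgeValue-suc {n} H e h =
  ≤-trans (∑pairs-mono pointwise) (≤-reflexive (∑pairs-+ (edgeValue H e h) (λ (_ _ : Fin n) → 1)))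
  where
  pointwise : ∀ i j → edgeValue H e (λ t → suc (h t)) i j ≤ edgeValue H e h i j + 1
  pointwise i j with H i j
  ... | true  = ≤-reflexive (+-comm 1 (h (radicand e i j)))
  ... | false = z≤n

rounding-budget : ∀ {S₁ S′ S N K D} → S₁ ≤ S′ + N → S′ + K ≤ S + D → D + suc N ≤ K → S₁ < S
rounding-budget {S₁} {S′} {S} {N} {K} {D} S₁≤ exchanged gap = +-cancelʳ-≤ K (suc S₁) S (begin
  suc S₁ + K           ≤⟨ +-monoˡ-≤ K (s≤s S₁≤) ⟩
  suc (S′ + N) + K     ≡⟨ shuffle S′ N K ⟩
  S′ + K + suc N       ≤⟨ +-monoˡ-≤ (suc N) exchanged ⟩
  S + D + suc N        ≡⟨ +-assoc S D (suc N) ⟩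
  S + (D + suc N)      ≤⟨ +-monoʳ-≤ S gap ⟩
  S + K                ∎)
  where
  open ≤-Reasoning
  shuffle : ∀ a b c → suc (a + b) + c ≡ a + c + suc b
  shuffle = solve-∀

rewiring-decreases-SO : ∀ {n} (G : Adj n) → IsSimple G → ∀ {u x y w} →
  G u x ≡ true → G w y ≡ true → G x y ≡ false → x ≢ y →
  3 ≤ deg G u → deg G x ≤ 2 → deg G y ≡ 1 → 2 ≤ deg G w →
  SOGt G (delAdd G u x y)
rewiring-decreases-SO {n} G simple {u} {x} {y} {w} ux wy xy x≢y 3≤u x≤2 y≡1 2≤w =
  Fractions.SqrtSumGt-by-scaledSqrt (pred M) (soTerms G) (soTerms G′) (subst₂ _<_
    (sym (sum-map-soTerms G′ (λ t → suc (φ t)))) (sym (sum-map-soTerms G φ))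
    (rounding-budget (∑pairs-edgeValue-suc G′ (deg G′) φ) (exchange wy y≡1 φ (scaledSqrt-mono M)) gap))
  where
  u≢y : u ≢ y
  u≢y refl = contradiction (≤-trans 3≤u (≤-reflexive y≡1)) λ { (s≤s ()) }
  open Rewiring G simple ux xy u≢y x≢y
  N : ℕ
  N = ∑pairs {n} (λ _ _ → 1)
  -- M is a successor, so suc (pred M) reduces to M.
  M : ℕ
  M = 10 * suc N
  φ : ℕ → ℕ
  φ = scaledSqrt M
  y≡2 : deg G′ y ≡ 2
  y≡2 = trans deg-y (cong (_+ 1) y≡1)
  w≢y : w ≢ y
  w≢y = adjacent⇒≢ simple wy
  gap : φ (radicand (deg G′) x y) + φ (radicand (deg G′) w y) + suc N
      ≤ φ (radicand (deg G) u x) + φ (radicand (deg G) w y)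
  gap = subst₂ _≤_
    (cong₂ (λ p q → φ (p * p + q * q) + φ (deg G′ w * deg G′ w + q * q) + suc N) (sym deg-x) (sym y≡2))
    (cong (λ q → φ (radicand (deg G) u x) + φ (deg G w * deg G w + q * q)) (sym y≡1))
    (sombor-gap (suc N) 3≤u x≤2 2≤w (deg-≤ w≢y))

lemma2p1 : ∀ {n : ℕ} (G : Adj n) → IsSimple G →
    (u x : Fin n) (ps : List (Fin n)) (v z : Fin n) (qs : List (Fin n)) →
    IsPendentPath G u x ps → IsPendentPath G v z qs →
    (u ∷ x ∷ ps) ≢ (v ∷ z ∷ qs) →
    SOGt G (delAdd G u x (lastOf z qs))
lemma2p1 G simple@(G-sym , _) u x ps v z qs P@(3≤u , ux , tP , _) Q@(3≤v , vz , tQ , _) P≢Q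
  with PendentPaths.last-neighbour G G-sym qs (≤-trans (n≤1+n 2) 3≤v) vz tQ
... | w , wy , 2≤w , w∈Q = rewiring-decreases-SO G simple ux wy xy x≢y 3≤u (tail-deg≤2 tP) y≡1 2≤w
  where
  open PendentPaths G G-sym
  y≡1 : deg G (lastOf z qs) ≡ 1
  y≡1 = last-deg≡1 qs tQ
  x∉Q : x ∉ v ∷ z ∷ qs
  x∉Q x∈Q with paths-through-first-vertex P Q x∈Q
  ... | refl , refl , refl = P≢Q refl
  x≢y : x ≢ lastOf z qs
  x≢y x≡y = x∉Q (there (subst (_∈ z ∷ qs) (sym x≡y) (lastOf-∈ z qs)))
  xy : G x (lastOf z qs) ≡ false
  xy = ¬-not λ xy → x∉Q (subst (_∈ v ∷ z ∷ qs) (deg≡1⇒neighbour-unique G y≡1 (adj-sym wy) (adj-sym xy)) w∈Q)
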